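{- For any finite group $G$ and positive integer $k$, $d_k(G) \le (k-1) f(G) + d(G)$.
   Context: For a finite group $G$ (written multiplicatively): a sequence in $G$ is a tuple $S=(a_1,\dots,a_n)$ of elements of $G$ (repetition allowed); a subsequence is obtained by choosing a nonempty subset of the index set, and two subsequences are disjoint if their index sets are disjoint. $S$ is a product-one sequence if $a_{\sigma(1)}\cdots a_{\sigma(n)}=1$ for some permutation $\sigma$. The Davenport constant $d(G)$ is the smallest positive integer $m$ such that every sequence in $G$ of length $m$ has a product-one subsequence. $f(G)$ is the smallest positive integer $m$ such that every sequence in $G$ of length $d(G)$ has a product-one subsequence of length at most $m$. For a positive integer $k$, the $k$-th Davenport constant $d_k(G)$ is the smallest positive integer $m$ such that every sequence in $G$ of length $m$ contains $k$ pairwise disjoint product-one subsequences. -}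

module Defs where

open import Level using (Level; _⊔_)
open import Algebra.Bundles using (Group)
open import Data.Nat using (ℕ; zero; suc; _≤_; _<_)
open import Data.Fin using (Fin; zero; suc)
open import Data.Fin.Subset using (Subset; Nonempty; Empty; _∩_; ∣_∣; inside; outside)
open import Data.Vec using ([]; _∷_)
open import Data.List using (List; []; _∷_; foldr; length)
open import Data.List.Relation.Binary.Permutation.Propositional using (_↭_)
open import Data.Product using (Σ; ∃; _×_; _,_)
open import Relation.Binary.PropositionalEquality using (_≢_)
open import Function using (_∘_)

select : ∀ {a} {A : Set a} {n : ℕ} → Subset n → (Fin n → A) → List A
select []            S = []
select (inside  ∷ p) S = S zero ∷ select p (S ∘ suc)
select (outside ∷ p) S = select p (S ∘ suc)

module _ {c ℓ : Level} (G : Group c ℓ) where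
  open Group G

  IsFiniteGroup : Set (c ⊔ ℓ)
  IsFiniteGroup = ∃ λ (n : ℕ) → Σ (Fin n → Carrier) λ e → ∀ x → ∃ λ i → e i ≈ x

  prod : List Carrier → Carrier
  prod = foldr _∙_ ε

  ProductOne : List Carrier → Set (c ⊔ ℓ)
  ProductOne xs = ∃ λ ys → (ys ↭ xs) × (prod ys ≈ ε)

  HasPO≤ : {n : ℕ} → ℕ → (Fin n → Carrier) → Set (c ⊔ ℓ)
  HasPO≤ bound S = ∃ λ T → Nonempty T × ∣ T ∣ ≤ bound × ProductOne (select T S)

  HasPO : {n : ℕ} → (Fin n → Carrier) → Set (c ⊔ ℓ)
  HasPO {n} S = HasPO≤ n S

  HasKDisjointPO : {n : ℕ} → ℕ → (Fin n → Carrier) → Set (c ⊔ ℓ)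
  HasKDisjointPO {n} k S =
    ∃ λ (T : Fin k → Subset n) →
      (∀ j → Nonempty (T j) × ProductOne (select (T j) S)) ×
      (∀ j j' → j ≢ j' → Empty (T j ∩ T j'))

  IsLeastPos : (ℕ → Set (c ⊔ ℓ)) → ℕ → Set (c ⊔ ℓ)
  IsLeastPos P m = (0 < m) × P m × (∀ m' → 0 < m' → P m' → m ≤ m')

  IsDavenport : ℕ → Set (c ⊔ ℓ)
  IsDavenport = IsLeastPos (λ m → (S : Fin m → Carrier) → HasPO S)

  IsF : ℕ → ℕ → Set (c ⊔ ℓ)
  IsF d = IsLeastPos (λ m → (S : Fin d → Carrier) → HasPO≤ m S)

  IsKDavenport : ℕ → ℕ → Set (c ⊔ ℓ)
  IsKDavenport k = IsLeastPos (λ m → (S : Fin m → Carrier) → HasKDisjointPO k S)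

-- Greedy extraction: any d indices carry a product-one subsequence of length at most f,
-- so from (k - 1) f + d indices one can remove such a subsequence, still keep at least
-- (k - 2) f + d indices, and repeat until k pairwise disjoint product-one subsequences
-- have been found.
module Submission where

open import Defs
open import Level using (Level)
open import Algebra.Bundles using (Group)
open import Data.Nat using (ℕ; zero; suc; _≤_; _<_; _+_; _*_; _∸_; z≤n; s≤s)
open import Data.Nat.Properties
  using (≤-trans; ≤-reflexive; m≤n+m; n≤1+n; +-suc; +-comm; +-assoc; +-monoʳ-≤; +-cancelˡ-≤; module ≤-Reasoning)
open import Data.Fin using (Fin; zero; suc)
open import Data.Fin.Subset using (Subset; Nonempty; Empty; _∩_; _─_; _⊆_; _∈_; _∉_; ∣_∣; inside; outside; ⊤; ⊥)
open import Data.Fin.Subset.Properties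
  using (out⊆; in⊆in; ⊆-trans; ⊥⊆; ∣⊥∣≡0; ∣⊤∣≡n; p─q⊆p; x∈p∩q⁻; ∩-comm)
open import Data.Vec using ([]; _∷_; here; there)
open import Data.Vec.Functional using (Vector) renaming (_∷_ to _◂_)
open import Data.List using (List)
open import Data.Product using (∃; _×_; _,_; map)
open import Data.Empty using (⊥-elim)
open import Function using (id; _∘_)
open import Relation.Binary.PropositionalEquality using (_≡_; _≢_; refl; sym; cong; subst)

PairwiseDisjoint : ∀ {k n} → Vector (Subset n) k → Set
PairwiseDisjoint T = ∀ i j → i ≢ j → Empty (T i ∩ T j)

∣p∣≤∣p─q∣+∣q∣ : ∀ {n} (p q : Subset n) → ∣ p ∣ ≤ ∣ p ─ q ∣ + ∣ q ∣
∣p∣≤∣p─q∣+∣q∣ []            []            = z≤n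
∣p∣≤∣p─q∣+∣q∣ (outside ∷ p) (outside ∷ q) = ∣p∣≤∣p─q∣+∣q∣ p q
∣p∣≤∣p─q∣+∣q∣ (inside  ∷ p) (outside ∷ q) = s≤s (∣p∣≤∣p─q∣+∣q∣ p q)
∣p∣≤∣p─q∣+∣q∣ (outside ∷ p) (inside  ∷ q) =
  ≤-trans (∣p∣≤∣p─q∣+∣q∣ p q) (+-monoʳ-≤ ∣ p ─ q ∣ (n≤1+n ∣ q ∣))
∣p∣≤∣p─q∣+∣q∣ (inside  ∷ p) (inside  ∷ q) =
  subst (suc ∣ p ∣ ≤_) (sym (+-suc ∣ p ─ q ∣ ∣ q ∣)) (s≤s (∣p∣≤∣p─q∣+∣q∣ p q))

x∈p─q⇒x∉q : ∀ {n} {x : Fin n} (p q : Subset n) → x ∈ p ─ q → x ∉ q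
x∈p─q⇒x∉q (_ ∷ p) (inside  ∷ q) (there x∈p─q) (there x∈q) = x∈p─q⇒x∉q p q x∈p─q x∈q
x∈p─q⇒x∉q (_ ∷ p) (outside ∷ q) (there x∈p─q) (there x∈q) = x∈p─q⇒x∉q p q x∈p─q x∈q

⊆─⇒disjoint : ∀ {n} {p q r : Subset n} → r ⊆ p ─ q → Empty (q ∩ r)
⊆─⇒disjoint {p = p} {q} {r} r⊆p─q (x , x∈q∩r) =
  let x∈q , x∈r = x∈p∩q⁻ q r x∈q∩r in x∈p─q⇒x∉q p q (r⊆p─q x∈r) x∈q

∷-pairwiseDisjoint : ∀ {k n} {p : Subset n} {T : Vector (Subset n) k} →
  (∀ i → Empty (p ∩ T i)) → PairwiseDisjoint T → PairwiseDisjoint (p ◂ T)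
∷-pairwiseDisjoint p#T T# zero    zero    0≢0 = ⊥-elim (0≢0 refl)
∷-pairwiseDisjoint p#T T# zero    (suc j) _   = p#T j
∷-pairwiseDisjoint {p = p} {T} p#T T# (suc i) zero _ = subst Empty (∩-comm p (T i)) (p#T i)
∷-pairwiseDisjoint p#T T# (suc i) (suc j) i≢j = T# i j (i≢j ∘ cong suc)

subsetOfSize : ∀ {n} (p : Subset n) {m} → m ≤ ∣ p ∣ → ∃ λ q → q ⊆ p × ∣ q ∣ ≡ m
subsetOfSize []            z≤n = [] , id , refl
subsetOfSize (outside ∷ p) m≤∣p∣ = map (outside ∷_) (map out⊆ id) (subsetOfSize p m≤∣p∣)
subsetOfSize {suc n} (inside ∷ p) {zero} _ = ⊥ , ⊥⊆ , ∣⊥∣≡0 (suc n)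
subsetOfSize (inside ∷ p) {suc m} (s≤s m≤∣p∣) =
  map (inside ∷_) (map in⊆in (cong suc)) (subsetOfSize p m≤∣p∣)

restrict : ∀ {a} {A : Set a} {n} (p : Subset n) → (Fin n → A) → Fin ∣ p ∣ → A
restrict (inside  ∷ p) S zero    = S zero
restrict (inside  ∷ p) S (suc i) = restrict p (S ∘ suc) i
restrict (outside ∷ p) S i       = restrict p (S ∘ suc) i

embed : ∀ {n} (p : Subset n) → Subset ∣ p ∣ → Subset n
embed []            q       = []
embed (inside  ∷ p) (s ∷ q) = s ∷ embed p q
embed (outside ∷ p) q       = outside ∷ embed p q

embed⊆ : ∀ {n} (p : Subset n) (q : Subset ∣ p ∣) → embed p q ⊆ p
embed⊆ []            q             = id
embed⊆ (inside  ∷ p) (inside  ∷ q) = in⊆in (embed⊆ p q)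
embed⊆ (inside  ∷ p) (outside ∷ q) = out⊆ (embed⊆ p q)
embed⊆ (outside ∷ p) q             = out⊆ (embed⊆ p q)

∣embed∣ : ∀ {n} (p : Subset n) (q : Subset ∣ p ∣) → ∣ embed p q ∣ ≡ ∣ q ∣
∣embed∣ []            []            = refl
∣embed∣ (inside  ∷ p) (inside  ∷ q) = cong suc (∣embed∣ p q)
∣embed∣ (inside  ∷ p) (outside ∷ q) = ∣embed∣ p q
∣embed∣ (outside ∷ p) q             = ∣embed∣ p q

embed-nonempty : ∀ {n} (p : Subset n) (q : Subset ∣ p ∣) → Nonempty q → Nonempty (embed p q)
embed-nonempty (inside  ∷ p) (inside  ∷ q) _ = zero , here
embed-nonempty (inside  ∷ p) (outside ∷ q) (suc x , there x∈q) = map suc there (embed-nonempty p q (x , x∈q))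
embed-nonempty (outside ∷ p) q q≢∅ = map suc there (embed-nonempty p q q≢∅)

select-embed : ∀ {a} {A : Set a} {n} (p : Subset n) (q : Subset ∣ p ∣) (S : Fin n → A) →
  select (embed p q) S ≡ select q (restrict p S)
select-embed []            []            S = refl
select-embed (inside  ∷ p) (inside  ∷ q) S = cong (List._∷_ (S zero)) (select-embed p q (S ∘ suc))
select-embed (inside  ∷ p) (outside ∷ q) S = select-embed p q (S ∘ suc)
select-embed (outside ∷ p) q             S = select-embed p q (S ∘ suc)

module _ {c ℓ : Level} (G : Group c ℓ) {d f : ℕ}
         (short : (S : Fin d → Group.Carrier G) → HasPO≤ G f S)
         {n : ℕ} (S : Fin n → Group.Carrier G) where

  ShortProductOne⊆ : Subset n → Subset n → Set _
  ShortProductOne⊆ A T = T ⊆ A × ∣ T ∣ ≤ f × Nonempty T × ProductOne G (select T S)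

  shortProductOne⊆ : ∀ {A} → d ≤ ∣ A ∣ → ∃ (ShortProductOne⊆ A)
  shortProductOne⊆ {A} d≤∣A∣ with subsetOfSize A d≤∣A∣
  ... | B , B⊆A , refl with short (restrict B S)
  ... | T , T≢∅ , ∣T∣≤f , T-po =
    embed B T , ⊆-trans (embed⊆ B T) B⊆A , subst (_≤ f) (sym (∣embed∣ B T)) ∣T∣≤f ,
    embed-nonempty B T T≢∅ , subst (ProductOne G) (sym (select-embed B T S)) T-po

  disjointProductOnes⊆ : ∀ j {A} → j * f + d ≤ ∣ A ∣ →
    ∃ λ (T : Vector (Subset n) (suc j)) → (∀ i → T i ⊆ A) ×
      (∀ i → Nonempty (T i) × ProductOne G (select (T i) S)) × PairwiseDisjoint T
  disjointProductOnes⊆ zero d≤∣A∣ =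
    let T , T⊆A , _ , T≢∅ , T-po = shortProductOne⊆ d≤∣A∣
    in (λ _ → T) , (λ _ → T⊆A) , (λ _ → T≢∅ , T-po) , λ { zero zero 0≢0 → ⊥-elim (0≢0 refl) }
  disjointProductOnes⊆ (suc j) {A} bound
    with shortProductOne⊆ (≤-trans (m≤n+m d (suc j * f)) bound)
  ... | T₀ , T₀⊆A , ∣T₀∣≤f , T₀≢∅ , T₀-po
    with disjointProductOnes⊆ j {A ─ T₀} remaining
    where
    open ≤-Reasoning
    remaining : j * f + d ≤ ∣ A ─ T₀ ∣
    remaining = +-cancelˡ-≤ f _ _ (begin
      f + (j * f + d)     ≡⟨ sym (+-assoc f (j * f) d) ⟩
      suc j * f + d       ≤⟨ bound ⟩
      ∣ A ∣               ≤⟨ ∣p∣≤∣p─q∣+∣q∣ A T₀ ⟩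
      ∣ A ─ T₀ ∣ + ∣ T₀ ∣ ≤⟨ +-monoʳ-≤ ∣ A ─ T₀ ∣ ∣T₀∣≤f ⟩
      ∣ A ─ T₀ ∣ + f      ≡⟨ +-comm ∣ A ─ T₀ ∣ f ⟩
      f + ∣ A ─ T₀ ∣      ∎)
  ... | T , T⊆A─T₀ , T-po , T# =
    T₀ ◂ T ,
    (λ { zero → T₀⊆A ; (suc i) → ⊆-trans (T⊆A─T₀ i) (p─q⊆p A T₀) }) ,
    (λ { zero → T₀≢∅ , T₀-po ; (suc i) → T-po i }) ,
    ∷-pairwiseDisjoint (λ i → ⊆─⇒disjoint (T⊆A─T₀ i)) T#

proposition1p9 : {c ℓ : Level} (G : Group c ℓ) → IsFiniteGroup G →
    (k : ℕ) → 0 < k →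
    (d f dk : ℕ) → IsDavenport G d → IsF G d f → IsKDavenport G k dk →
    dk ≤ (k ∸ 1) * f + d
proposition1p9 G _ (suc j) _ d f dk (0<d , _ , _) (_ , short , _) (_ , _ , dk-least) =
  dk-least (j * f + d) (≤-trans 0<d (m≤n+m d (j * f))) λ S →
    let T , _ , T-po , T# = disjointProductOnes⊆ G short S j {⊤} (≤-reflexive (sym (∣⊤∣≡n _)))
    in T , T-po , T#
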